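{- If $n\ge2$, then the average number of peaks in $\mathrm{Flatten}(\pi)$, taken over all $\pi\in\mathcal S_n$, equals $\frac{n-2}{3}$.
   Context: $\mathcal S_n$ is the set of permutations of $[n]$. For $\pi\in\mathcal S_n$ written in standard cycle form (each cycle begins with its smallest element, cycles ordered left to right by increasing smallest elements), $\mathrm{Flatten}(\pi)$ is the word obtained by erasing the parentheses. A peak of a word $w$ is an index $i$ with $w_{i+1}=\max\{w_i,w_{i+1},w_{i+2}\}$. -}

module Defs where

open import Data.Nat using (ℕ; zero; suc; _+_; _≡ᵇ_; _≤ᵇ_)
open import Data.Bool using (Bool; true; false; if_then_else_; _∧_)
open import Data.List using (List; []; _∷_; _++_; map; upTo)
open import Data.Bool.ListAction using (any)

range1 : ℕ → List ℕ
range1 n = map suc (upTo n)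

-- A permutation π ∈ S_n is given in one-line notation as a list w = π(1) … π(n).
-- app w i = π(i) = the i-th entry (1-based) of w (0 if out of range).
app : List ℕ → ℕ → ℕ
app [] _ = 0
app (x ∷ xs) zero = 0
app (x ∷ xs) (suc zero) = x
app (x ∷ xs) (suc (suc i)) = app xs (suc i)

-- orbit f s c k : the cycle of f through the start s, listed from c,
-- stopping when f returns to s (fuel k bounds the length).
orbit : (ℕ → ℕ) → ℕ → ℕ → ℕ → List ℕ
orbit f s c zero = []
orbit f s c (suc k) = c ∷ (if f c ≡ᵇ s then [] else orbit f s (f c) k)

memb : ℕ → List ℕ → Bool
memb i vs = any (λ v → v ≡ᵇ i) vs

-- walk the candidates 1..n in increasing order; each not-yet-visited
-- candidate is the smallest element of a new cycle, written starting from it.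
flattenGo : (ℕ → ℕ) → ℕ → List ℕ → List ℕ → List ℕ
flattenGo f n [] vis = []
flattenGo f n (i ∷ is) vis with memb i vis
... | true = flattenGo f n is vis
... | false = orbit f i i n ++ flattenGo f n is (orbit f i i n ++ vis)

-- Flatten(π): standard cycle form with parentheses erased.
Flatten : ℕ → List ℕ → List ℕ
Flatten n w = flattenGo (app w) n (range1 n) []

peaks : List ℕ → ℕ
peaks (a ∷ b ∷ c ∷ r) = (if (a ≤ᵇ b) ∧ (c ≤ᵇ b) then 1 else 0) + peaks (b ∷ c ∷ r)
peaks _ = 0

-- Every permutation of [n+1] arises exactly once from some σ ∈ S_n, either by adjoining the fixed
-- point n+1 or by inserting n+1 into the cycle of some j right after j.  Reading Flatten off a
-- standard cycle decomposition that is carried along, the first operation appends n+1 to Flatten σ,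
-- which creates no peak, and the second inserts n+1 right after the letter j, which makes n+1 a peak
-- and destroys the peaks at its two neighbours.  Summing over j, the n+1 children of σ have
-- (n-1)(peaks(Flatten σ) + 1) peaks in total, so the totals satisfy T(n+1) = (n-1)(T(n) + n!), and
-- 3 T(n) = (n-2) n! follows by induction.

module Submission where

open import Defs
open import Data.Bool using (true; false; if_then_else_; _∧_; T)
open import Data.Bool.Properties using (∧-zeroʳ)
open import Data.Empty using (⊥-elim)
open import Data.Nat using (ℕ; zero; suc; _+_; _*_; _∸_; _≤_; _<_; z≤n; s≤s; _≡ᵇ_; _≤ᵇ_)
open import Data.Nat.Properties
open import Data.Nat.ListAction using (sum)
open import Data.Nat.ListAction.Properties using (sum-++; sum-↭)
open import Data.Nat.Tactic.RingSolver using (solve-∀)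
open import Data.List using (List; []; _∷_; _++_; _∷ʳ_; map; length; upTo; applyUpTo; concatMap; InitLast; initLast; _∷ʳ′_)
open import Data.List.Properties using (map-∘; map-cong-local; map-applyUpTo; ∷-injectiveˡ; ∷-injectiveʳ; ∷ʳ-injective; ++-identityʳ; ++-assoc; length-++; length-map; map-++; length-upTo; upTo-∷ʳ)
open import Data.List.Membership.Propositional using (_∈_; _∉_; find; lose)
open import Data.List.Membership.Propositional.Properties using (∈-++⁺ˡ; ∈-++⁺ʳ; ∈-++⁻; ∈-∃++; ∈-map⁺; ∈-map⁻; ∈-upTo⁺; ∈-upTo⁻; ∈-concatMap⁺; ∈-concatMap⁻)
open import Data.List.Relation.Unary.Any using (here; there)
import Data.List.Relation.Unary.Any as Any
open import Data.List.Relation.Unary.Any.Properties using (any⁺; any⁻)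
open import Data.List.Relation.Unary.All using (All; []; _∷_)
import Data.List.Relation.Unary.All as All
import Data.List.Relation.Unary.All.Properties as Allₚ
open import Data.List.Relation.Unary.AllPairs using (AllPairs; []; _∷_)
import Data.List.Relation.Unary.AllPairs.Properties as AllPairs
open import Data.List.Relation.Unary.Unique.Propositional using (Unique)
open import Data.List.Relation.Unary.Unique.Propositional.Properties
  using (Unique[x∷xs]⇒x∉xs) renaming (map⁺ to Unique-map⁺; upTo⁺ to Unique-upTo⁺; ++⁺ to Unique-++⁺)
open import Data.List.Relation.Binary.Subset.Propositional using (_⊆_)
open import Data.List.Relation.Binary.Disjoint.Propositional using (Disjoint)
open import Data.List.Relation.Binary.Permutation.Propositional using (_↭_; ↭-refl; ↭-sym; ↭-trans; ↭-prep; ↭-reflexive; ↭⇒↭ₛ)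
open import Data.List.Relation.Binary.Permutation.Propositional.Properties using (∈-resp-↭; ↭-length; ↭-empty-inv; ++⁺ˡ; ++⁺ʳ; ∷↭∷ʳ; shift; drop-mid; map⁺)
import Data.List.Relation.Binary.Permutation.Setoid.Properties as PermutationSetoid
open import Data.List.Relation.Binary.BagAndSetEquality using (∼bag⇒↭)
open import Data.List.Membership.Propositional.Properties.WithK using (unique∧set⇒bag)
open import Data.Product using (∃-syntax; _×_; _,_; proj₁; proj₂)
open import Data.Sum using (_⊎_; inj₁; inj₂; map₂)
open import Data.Unit using (⊤; tt)
open import Function.Base using (id; _∘_)
open import Function.Bundles using (_⇔_; mk⇔; Equivalence)
open import Relation.Binary.PropositionalEquality using (_≡_; _≢_; refl; sym; trans; cong; cong₂; subst; subst₂; setoid)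
open Relation.Binary.PropositionalEquality.≡-Reasoning

≡ᵇ⇒≡′ : ∀ {m n} → (m ≡ᵇ n) ≡ true → m ≡ n
≡ᵇ⇒≡′ {m} {n} e = ≡ᵇ⇒≡ m n (subst T (sym e) tt)

≡ᵇ-refl : ∀ n → (n ≡ᵇ n) ≡ true
≡ᵇ-refl zero    = refl
≡ᵇ-refl (suc n) = ≡ᵇ-refl n

≢⇒≡ᵇ-false : ∀ {m n} → m ≢ n → (m ≡ᵇ n) ≡ false
≢⇒≡ᵇ-false {m} {n} m≢n with m ≡ᵇ n in e
... | true  = ⊥-elim (m≢n (≡ᵇ⇒≡′ e))
... | false = refl

≡ᵇ-false⇒≢ : ∀ {m n} → (m ≡ᵇ n) ≡ false → m ≢ n
≡ᵇ-false⇒≢ {m} e refl with trans (sym (≡ᵇ-refl m)) e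
... | ()

≤⇒≤ᵇ≡true : ∀ {m n} → m ≤ n → (m ≤ᵇ n) ≡ true
≤⇒≤ᵇ≡true {m} {n} m≤n with m ≤ᵇ n in e
... | true  = refl
... | false = ⊥-elim (subst T e (≤⇒≤ᵇ m≤n))

>⇒≤ᵇ≡false : ∀ {m n} → n < m → (m ≤ᵇ n) ≡ false
>⇒≤ᵇ≡false {m} {n} n<m with m ≤ᵇ n in e
... | true  = ⊥-elim (<⇒≱ n<m (≤ᵇ⇒≤ m n (subst T (sym e) tt)))
... | false = refl

memb≡true⇒∈ : ∀ {i} vs → memb i vs ≡ true → i ∈ vs
memb≡true⇒∈ {i} vs e =
  Any.map (λ t → sym (≡ᵇ⇒≡ _ i t)) (any⁻ (λ v → v ≡ᵇ i) vs (subst T (sym e) tt))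

memb≡false⇒∉ : ∀ {i} vs → memb i vs ≡ false → i ∉ vs
memb≡false⇒∉ {i} vs e i∈vs =
  subst T e (any⁺ (λ v → v ≡ᵇ i) (Any.map (λ i≡v → ≡⇒≡ᵇ _ i (sym i≡v)) i∈vs))

Unique-++⁻ˡ : ∀ (xs : List ℕ) {ys} → Unique (xs ++ ys) → Unique xs
Unique-++⁻ˡ []       _          = []
Unique-++⁻ˡ (x ∷ xs) (px ∷ pxs) = Allₚ.++⁻ˡ xs px ∷ Unique-++⁻ˡ xs pxs

Unique-++⁻ʳ : ∀ (xs : List ℕ) {ys} → Unique (xs ++ ys) → Unique ys
Unique-++⁻ʳ []       u         = u
Unique-++⁻ʳ (x ∷ xs) (_ ∷ pxs) = Unique-++⁻ʳ xs pxs

Unique-++⁻-disjoint : ∀ (xs : List ℕ) {ys} → Unique (xs ++ ys) → Disjoint xs ys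
Unique-++⁻-disjoint (x ∷ xs) (px ∷ _)   (here refl , y∈ys) = Allₚ.All¬⇒¬Any (Allₚ.++⁻ʳ xs px) y∈ys
Unique-++⁻-disjoint (x ∷ xs) (_  ∷ pxs) (there v∈xs , v∈ys) = Unique-++⁻-disjoint xs pxs (v∈xs , v∈ys)

Unique-resp-↭ : ∀ {xs ys : List ℕ} → xs ↭ ys → Unique xs → Unique ys
Unique-resp-↭ p = PermutationSetoid.Unique-resp-↭ (setoid ℕ) (↭⇒↭ₛ p)

range1-⁻ : ∀ {x m} → x ∈ range1 m → 1 ≤ x × x ≤ m
range1-⁻ x∈ with ∈-map⁻ suc x∈
... | _ , y∈ , refl = s≤s z≤n , ∈-upTo⁻ y∈

range1-⁺ : ∀ {x m} → 1 ≤ x → x ≤ m → x ∈ range1 m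
range1-⁺ {suc _} (s≤s _) x≤m = ∈-map⁺ suc (∈-upTo⁺ x≤m)

range1-unique : ∀ m → Unique (range1 m)
range1-unique m = Unique-map⁺ suc-injective (Unique-upTo⁺ m)

range1-sorted : ∀ m → AllPairs _<_ (range1 m)
range1-sorted m = AllPairs.map⁺ (AllPairs.applyUpTo⁺₁ id m (λ i<j _ → s≤s i<j))

length-range1 : ∀ m → length (range1 m) ≡ m
length-range1 m = trans (length-map suc (upTo m)) (length-upTo m)

range1-suc : ∀ m → range1 (suc m) ≡ range1 m ∷ʳ suc m
range1-suc m = trans (cong (map suc) (sym (upTo-∷ʳ m))) (map-++ suc (upTo m) (m ∷ []))

-- Standard cycle decompositions and Flatten

Cycle : Set
Cycle = ℕ × List ℕ

concatCycles : List Cycle → List ℕ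
concatCycles []            = []
concatCycles ((h , r) ∷ C) = h ∷ r ++ concatCycles C

Chain : (ℕ → ℕ) → ℕ → ℕ → List ℕ → Set
Chain f h y []      = f y ≡ h
Chain f h y (z ∷ r) = f y ≡ z × Chain f h z r

CyclesOf : (ℕ → ℕ) → List Cycle → Set
CyclesOf f []            = ⊤
CyclesOf f ((h , r) ∷ C) = Chain f h h r × CyclesOf f C

Standard : List Cycle → Set
Standard []            = ⊤
Standard ((h , r) ∷ C) = (∀ {x} → x ∈ r ++ concatCycles C → h ≤ x) × Standard C

StandardDecomposition : ℕ → (ℕ → ℕ) → List Cycle → Set
StandardDecomposition m f C = (concatCycles C ↭ range1 m) × Standard C × CyclesOf f C

orbit-Chain : ∀ {f h y r k} → Chain f h y r → h ∉ r → length r < k → orbit f h y k ≡ y ∷ r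
orbit-Chain {f} {h} {y} {[]}    {suc k} fy≡h       _   _
  rewrite fy≡h | ≡ᵇ-refl h = refl
orbit-Chain {f} {h} {y} {z ∷ r} {suc k} (fy≡z , ch) h∉ (s≤s r<k)
  rewrite fy≡z | ≢⇒≡ᵇ-false (λ z≡h → h∉ (here (sym z≡h)))
  = cong (y ∷_) (orbit-Chain ch (h∉ ∘ there) r<k)

least-head : ∀ {i is h rest} → All (i <_) is → h ∈ i ∷ is → i ∈ h ∷ rest →
             (∀ {x} → x ∈ rest → h ≤ x) → h ≡ i
least-head _    (here h≡i)  _            _  = h≡i
least-head i<is (there h∈is) (here i≡h)  _  = ⊥-elim (<-irrefl i≡h (All.lookup i<is h∈is))
least-head i<is (there h∈is) (there i∈r) h≤ = ⊥-elim (<⇒≱ (All.lookup i<is h∈is) (h≤ i∈r))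

-- flattenGo scans the candidates in increasing order, so the first unvisited one is the least entry
-- of the remaining cycles, i.e. the head of the next standard cycle, and orbit lists that cycle.
flattenGo-cycles : ∀ f k is vis C → AllPairs _<_ is →
  concatCycles C ⊆ is → (∀ {x} → x ∈ is → x ∈ vis ⊎ x ∈ concatCycles C) →
  Disjoint vis (concatCycles C) → Unique (concatCycles C) → Standard C → CyclesOf f C →
  length (concatCycles C) ≤ k → flattenGo f k is vis ≡ concatCycles C
flattenGo-cycles f k []       vis []            _ _   _ _ _ _ _ _ = refl
flattenGo-cycles f k []       vis ((h , r) ∷ C) _ sub _ _ _ _ _ _ with () ← sub (here refl)
flattenGo-cycles f k (i ∷ is) vis C (i<is ∷ sorted) sub cov disj u std cyc len with memb i vis in e
... | true = flattenGo-cycles f k is vis C sorted sub′ (cov ∘ there) disj u std cyc len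
  where
  sub′ : concatCycles C ⊆ is
  sub′ x∈C with sub x∈C
  ... | here refl  = ⊥-elim (disj (memb≡true⇒∈ vis e , x∈C))
  ... | there x∈is = x∈is
... | false with cov (here refl)
...   | inj₁ i∈vis = ⊥-elim (memb≡false⇒∉ vis e i∈vis)
flattenGo-cycles f k (i ∷ is) vis ((h , r) ∷ C) (i<is ∷ sorted) sub cov disj u (h≤ , std) (ch , cyc) len
  | false | inj₂ i∈C with least-head i<is (sub (here refl)) i∈C h≤
... | refl = subst (λ o → o ++ flattenGo f k is (o ++ vis) ≡ h ∷ r ++ concatCycles C) (sym orbit≡)
    (cong ((h ∷ r) ++_)
      (flattenGo-cycles f k is (h ∷ r ++ vis) C sorted sub′ cov′ disj′ (Unique-++⁻ʳ (h ∷ r) u) std cyc len′))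
  where
  r<k : length r < k
  r<k = ≤-trans (s≤s (subst (length r ≤_) (sym (length-++ r)) (m≤m+n _ _))) len
  orbit≡ : orbit f h h k ≡ h ∷ r
  orbit≡ = orbit-Chain ch (Unique[x∷xs]⇒x∉xs (Unique-++⁻ˡ (h ∷ r) u)) r<k
  len′ : length (concatCycles C) ≤ k
  len′ = ≤-trans (m≤n+m _ (suc (length r))) (subst (_≤ k) (cong suc (length-++ r)) len)
  sub′ : concatCycles C ⊆ is
  sub′ x∈C with sub (there (∈-++⁺ʳ r x∈C))
  ... | here refl  = ⊥-elim (Unique-++⁻-disjoint (h ∷ r) u (here refl , x∈C))
  ... | there x∈is = x∈is
  cov′ : ∀ {x} → x ∈ is → x ∈ h ∷ r ++ vis ⊎ x ∈ concatCycles C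
  cov′ x∈is with cov (there x∈is)
  ... | inj₁ x∈vis = inj₁ (∈-++⁺ʳ (h ∷ r) x∈vis)
  ... | inj₂ x∈hrC with ∈-++⁻ (h ∷ r) x∈hrC
  ...   | inj₁ x∈hr = inj₁ (∈-++⁺ˡ x∈hr)
  ...   | inj₂ x∈C  = inj₂ x∈C
  disj′ : Disjoint (h ∷ r ++ vis) (concatCycles C)
  disj′ (x∈hrv , x∈C) with ∈-++⁻ (h ∷ r) x∈hrv
  ... | inj₁ x∈hr  = Unique-++⁻-disjoint (h ∷ r) u (x∈hr , x∈C)
  ... | inj₂ x∈vis = disj (x∈vis , ∈-++⁺ʳ (h ∷ r) x∈C)

Flatten-standard : ∀ {m} w {C} → StandardDecomposition m (app w) C → Flatten m w ≡ concatCycles C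
Flatten-standard {m} w {C} (C↭ , std , cyc) =
  flattenGo-cycles (app w) m (range1 m) [] C (range1-sorted m)
    (∈-resp-↭ C↭) (λ x∈ → inj₂ (∈-resp-↭ (↭-sym C↭) x∈)) (λ ())
    (Unique-resp-↭ (↭-sym C↭) (range1-unique m)) std cyc
    (≤-reflexive (trans (↭-length C↭) (length-range1 m)))

-- Inserting a new maximum

app-++ˡ : ∀ xs ys {i} → 1 ≤ i → i ≤ length xs → app (xs ++ ys) i ≡ app xs i
app-++ˡ (x ∷ xs) ys {suc zero}    _ _         = refl
app-++ˡ (x ∷ xs) ys {suc (suc i)} _ (s≤s i≤) = app-++ˡ xs ys (s≤s z≤n) i≤

app-++-∷ : ∀ p (x : ℕ) s → app (p ++ x ∷ s) (suc (length p)) ≡ x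
app-++-∷ []      x s = refl
app-++-∷ (_ ∷ p) x s = app-++-∷ p x s

app-++-∷-≢ : ∀ p (x y : ℕ) s {i} → i ≢ suc (length p) → app (p ++ x ∷ s) i ≡ app (p ++ y ∷ s) i
app-++-∷-≢ []      x y s {zero}        _  = refl
app-++-∷-≢ []      x y s {suc zero}    i≢ = ⊥-elim (i≢ refl)
app-++-∷-≢ []      x y s {suc (suc i)} _  = refl
app-++-∷-≢ (_ ∷ p) x y s {zero}        _  = refl
app-++-∷-≢ (_ ∷ p) x y s {suc zero}    _  = refl
app-++-∷-≢ (_ ∷ p) x y s {suc (suc i)} i≢ = app-++-∷-≢ p x y s (i≢ ∘ cong suc)

insertAfter     : ℕ → ℕ → List ℕ → List ℕ
insertAfterTail : ℕ → ℕ → ℕ → List ℕ → List ℕ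

insertAfter j N []       = []
insertAfter j N (x ∷ xs) = x ∷ insertAfterTail j N x xs

insertAfterTail j N x xs = if x ≡ᵇ j then N ∷ insertAfter j N xs else insertAfter j N xs

insertInCycle : ℕ → ℕ → Cycle → Cycle
insertInCycle j N (h , r) = h , insertAfterTail j N h r

insertAfter-++     : ∀ j N xs ys → insertAfter j N (xs ++ ys) ≡ insertAfter j N xs ++ insertAfter j N ys
insertAfterTail-++ : ∀ j N x xs ys →
  insertAfterTail j N x (xs ++ ys) ≡ insertAfterTail j N x xs ++ insertAfter j N ys

insertAfter-++ j N []       ys = refl
insertAfter-++ j N (x ∷ xs) ys = cong (x ∷_) (insertAfterTail-++ j N x xs ys)

insertAfterTail-++ j N x xs ys with x ≡ᵇ j
... | true  = cong (N ∷_) (insertAfter-++ j N xs ys)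
... | false = insertAfter-++ j N xs ys

insertAfter-∉ : ∀ {j} N xs → j ∉ xs → insertAfter j N xs ≡ xs
insertAfter-∉     N []       _  = refl
insertAfter-∉ {j} N (x ∷ xs) j∉ rewrite ≢⇒≡ᵇ-false {x} {j} (λ x≡j → j∉ (here (sym x≡j))) =
  cong (x ∷_) (insertAfter-∉ N xs (j∉ ∘ there))

∈-insertAfter⁻     : ∀ {x} j N xs → x ∈ insertAfter j N xs → x ≡ N ⊎ x ∈ xs
∈-insertAfterTail⁻ : ∀ {x} j N y xs → x ∈ insertAfterTail j N y xs → x ≡ N ⊎ x ∈ xs

∈-insertAfter⁻ j N (y ∷ xs) (here x≡y) = inj₂ (here x≡y)
∈-insertAfter⁻ j N (y ∷ xs) (there x∈) = map₂ there (∈-insertAfterTail⁻ j N y xs x∈)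

∈-insertAfterTail⁻ j N y xs x∈ with y ≡ᵇ j
∈-insertAfterTail⁻ j N y xs (here x≡N) | true = inj₁ x≡N
∈-insertAfterTail⁻ j N y xs (there x∈) | true = ∈-insertAfter⁻ j N xs x∈
... | false = ∈-insertAfter⁻ j N xs x∈

insertAfter-↭ : ∀ {j} N u → Unique u → j ∈ u → insertAfter j N u ↭ u ∷ʳ N
insertAfter-↭ {j} N u u! j∈u with ∈-∃++ j∈u
... | p , q , refl = ↭-trans (↭-reflexive inserted)
  (↭-trans (++⁺ˡ p (↭-prep j (∷↭∷ʳ N q))) (↭-reflexive (sym (++-assoc p (j ∷ q) (N ∷ [])))))
  where
  inserted : insertAfter j N (p ++ j ∷ q) ≡ p ++ j ∷ N ∷ q
  inserted rewrite insertAfter-++ j N p (j ∷ q)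
                 | insertAfter-∉ N p (λ j∈p → Unique-++⁻-disjoint p u! (j∈p , here refl))
                 | ≡ᵇ-refl j
                 | insertAfter-∉ N q (Unique[x∷xs]⇒x∉xs (Unique-++⁻ʳ p u!)) = refl

concatCycles-++ : ∀ C D → concatCycles (C ++ D) ≡ concatCycles C ++ concatCycles D
concatCycles-++ []            D = refl
concatCycles-++ ((h , r) ∷ C) D =
  cong (h ∷_) (trans (cong (r ++_) (concatCycles-++ C D)) (sym (++-assoc r (concatCycles C) _)))

concatCycles-insert : ∀ j N C → concatCycles (map (insertInCycle j N) C) ≡ insertAfter j N (concatCycles C)
concatCycles-insert j N []            = refl
concatCycles-insert j N ((h , r) ∷ C) = cong (h ∷_)
  (trans (cong (insertAfterTail j N h r ++_) (concatCycles-insert j N C))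
         (sym (insertAfterTail-++ j N h r (concatCycles C))))

Chain-cong : ∀ {f g h} y r → (∀ {x} → x ∈ y ∷ r → g x ≡ f x) → Chain f h y r → Chain g h y r
Chain-cong y []      g≗f fy≡h       = trans (g≗f (here refl)) fy≡h
Chain-cong y (z ∷ r) g≗f (fy≡z , ch) = trans (g≗f (here refl)) fy≡z , Chain-cong z r (g≗f ∘ there) ch

CyclesOf-cong : ∀ {f g} C → (∀ {x} → x ∈ concatCycles C → g x ≡ f x) → CyclesOf f C → CyclesOf g C
CyclesOf-cong []            _   _          = tt
CyclesOf-cong ((h , r) ∷ C) g≗f (ch , cyc) =
  Chain-cong h r (g≗f ∘ ∈-++⁺ˡ) ch , CyclesOf-cong C (g≗f ∘ ∈-++⁺ʳ (h ∷ r)) cyc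

CyclesOf-∷ʳ : ∀ {g N} C → CyclesOf g C → g N ≡ N → CyclesOf g (C ∷ʳ (N , []))
CyclesOf-∷ʳ []            _          gN≡N = gN≡N , tt
CyclesOf-∷ʳ ((h , r) ∷ C) (ch , cyc) gN≡N = ch , CyclesOf-∷ʳ C cyc gN≡N

-- Making g agree with f except that g j = N and g N = f j splices N into the cycle of j.
Chain-insert : ∀ {f g h j N} y r → Chain f h y r → (∀ {x} → x ∈ y ∷ r → x ≢ j → g x ≡ f x) →
  g j ≡ N → g N ≡ f j → Chain g h y (insertAfterTail j N y r)
Chain-insert {j = j} y [] fy≡h g≗f gj≡N gN≡fj with y ≡ᵇ j in y≡ᵇj
... | true with refl ← ≡ᵇ⇒≡′ {y} {j} y≡ᵇj = gj≡N , trans gN≡fj fy≡h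
... | false = trans (g≗f (here refl) (≡ᵇ-false⇒≢ {y} {j} y≡ᵇj)) fy≡h
Chain-insert {j = j} y (z ∷ r) (fy≡z , ch) g≗f gj≡N gN≡fj with y ≡ᵇ j in y≡ᵇj
... | true with refl ← ≡ᵇ⇒≡′ {y} {j} y≡ᵇj =
  gj≡N , trans gN≡fj fy≡z , Chain-insert z r ch (g≗f ∘ there) gj≡N gN≡fj
... | false =
  trans (g≗f (here refl) (≡ᵇ-false⇒≢ {y} {j} y≡ᵇj)) fy≡z , Chain-insert z r ch (g≗f ∘ there) gj≡N gN≡fj

CyclesOf-insert : ∀ {f g j N} C → CyclesOf f C → (∀ {x} → x ∈ concatCycles C → x ≢ j → g x ≡ f x) →
  g j ≡ N → g N ≡ f j → CyclesOf g (map (insertInCycle j N) C)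
CyclesOf-insert []            _          _   _    _    = tt
CyclesOf-insert ((h , r) ∷ C) (ch , cyc) g≗f gj≡N gN≡fj =
  Chain-insert h r ch (g≗f ∘ ∈-++⁺ˡ) gj≡N gN≡fj ,
  CyclesOf-insert C cyc (g≗f ∘ ∈-++⁺ʳ (h ∷ r)) gj≡N gN≡fj

Standard-insert : ∀ {j N} C → Standard C → (∀ {x} → x ∈ concatCycles C → x < N) →
  Standard (map (insertInCycle j N) C)
Standard-insert         []            _          _  = tt
Standard-insert {j} {N} ((h , r) ∷ C) (h≤ , std) <N = h≤′ , Standard-insert C std (<N ∘ ∈-++⁺ʳ (h ∷ r))
  where
  h≤′ : ∀ {x} → x ∈ insertAfterTail j N h r ++ concatCycles (map (insertInCycle j N) C) → h ≤ x
  h≤′ x∈ with ∈-insertAfterTail⁻ j N h (r ++ concatCycles C)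
                (subst (_ ∈_) (∷-injectiveʳ (concatCycles-insert j N ((h , r) ∷ C))) x∈)
  ... | inj₁ refl = <⇒≤ (<N (here refl))
  ... | inj₂ x∈rC = h≤ x∈rC

Standard-∷ʳ : ∀ {N} C → Standard C → (∀ {x} → x ∈ concatCycles C → x < N) → Standard (C ∷ʳ (N , []))
Standard-∷ʳ         []            _          _  = (λ ()) , tt
Standard-∷ʳ {N} ((h , r) ∷ C) (h≤ , std) <N = h≤′ , Standard-∷ʳ C std (<N ∘ ∈-++⁺ʳ (h ∷ r))
  where
  h≤′ : ∀ {x} → x ∈ r ++ concatCycles (C ∷ʳ (N , [])) → h ≤ x
  h≤′ x∈ rewrite concatCycles-++ C ((N , []) ∷ []) | sym (++-assoc r (concatCycles C) (N ∷ []))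
    with ∈-++⁻ (r ++ concatCycles C) x∈
  ... | inj₁ x∈rC      = h≤ x∈rC
  ... | inj₂ (here refl) = <⇒≤ (<N (here refl))

entries-range : ∀ {m f C x} → StandardDecomposition m f C → x ∈ concatCycles C → 1 ≤ x × x ≤ m
entries-range (C↭ , _) x∈C = range1-⁻ (∈-resp-↭ C↭ x∈C)

suc-length≤ : ∀ p (a : ℕ) q → suc (length p) ≤ length (p ++ a ∷ q)
suc-length≤ []      a q = s≤s z≤n
suc-length≤ (_ ∷ p) a q = s≤s (suc-length≤ p a q)

appendMax-decomposition : ∀ {m} w {C} → length w ≡ m → StandardDecomposition m (app w) C →
  StandardDecomposition (suc m) (app (w ∷ʳ suc m)) (C ∷ʳ (suc m , []))
appendMax-decomposition w {C} refl d@(C↭ , std , cyc) =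
  C′↭ , Standard-∷ʳ C std (s≤s ∘ proj₂ ∘ entries-range d) ,
  CyclesOf-∷ʳ C (CyclesOf-cong C agree cyc) (app-++-∷ w _ [])
  where
  N = suc (length w)
  C′↭ : concatCycles (C ∷ʳ (N , [])) ↭ range1 N
  C′↭ rewrite concatCycles-++ C ((N , []) ∷ []) | range1-suc (length w) = ++⁺ʳ (N ∷ []) C↭
  agree : ∀ {x} → x ∈ concatCycles C → app (w ∷ʳ N) x ≡ app w x
  agree x∈C = app-++ˡ w _ (proj₁ (entries-range d x∈C)) (proj₂ (entries-range d x∈C))

-- π ↦ π' with π'(j) = N and π'(N) = π(j), where j = |p| + 1: N enters the cycle of j right after j.
splitMax-decomposition : ∀ {m} p a q {C} → length (p ++ a ∷ q) ≡ m →
  StandardDecomposition m (app (p ++ a ∷ q)) C →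
  StandardDecomposition (suc m) (app (p ++ suc m ∷ q ∷ʳ a)) (map (insertInCycle (suc (length p)) (suc m)) C)
splitMax-decomposition p a q {C} refl d@(C↭ , std , cyc) =
  C′↭ , Standard-insert C std (s≤s ∘ proj₂ ∘ entries-range d) ,
  CyclesOf-insert C cyc agree (app-++-∷ p N (q ∷ʳ a)) gN≡fj
  where
  w = p ++ a ∷ q
  j = suc (length p)
  N = suc (length w)
  u! : Unique (concatCycles C)
  u! = Unique-resp-↭ (↭-sym C↭) (range1-unique (length w))
  j∈C : j ∈ concatCycles C
  j∈C = ∈-resp-↭ (↭-sym C↭) (range1-⁺ (s≤s z≤n) (suc-length≤ p a q))
  C′↭ : concatCycles (map (insertInCycle j N) C) ↭ range1 N
  C′↭ rewrite concatCycles-insert j N C | range1-suc (length w) =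
    ↭-trans (insertAfter-↭ N (concatCycles C) u! j∈C) (++⁺ʳ (N ∷ []) C↭)
  agree : ∀ {x} → x ∈ concatCycles C → x ≢ j → app (p ++ N ∷ q ∷ʳ a) x ≡ app w x
  agree {x} x∈C x≢j = begin
    app (p ++ N ∷ q ∷ʳ a) x    ≡⟨ app-++-∷-≢ p N a (q ∷ʳ a) x≢j ⟩
    app (p ++ a ∷ q ∷ʳ a) x    ≡⟨ cong (λ l → app l x) (sym (++-assoc p (a ∷ q) (a ∷ []))) ⟩
    app (w ∷ʳ a) x             ≡⟨ app-++ˡ w _ (proj₁ (entries-range d x∈C)) (proj₂ (entries-range d x∈C)) ⟩
    app w x                    ∎
  gN≡fj : app (p ++ N ∷ q ∷ʳ a) N ≡ app w j
  gN≡fj = begin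
    app (p ++ N ∷ q ∷ʳ a) N        ≡⟨ cong (λ l → app l N) (sym (++-assoc p (N ∷ q) (a ∷ []))) ⟩
    app ((p ++ N ∷ q) ∷ʳ a) N      ≡⟨ cong (λ n → app ((p ++ N ∷ q) ∷ʳ a) (suc n)) same-length ⟩
    app ((p ++ N ∷ q) ∷ʳ a) (suc (length (p ++ N ∷ q))) ≡⟨ app-++-∷ (p ++ N ∷ q) a [] ⟩
    a                              ≡⟨ sym (app-++-∷ p a q) ⟩
    app w j                        ∎
    where
    same-length : length w ≡ length (p ++ N ∷ q)
    same-length = trans (length-++ p) (sym (length-++ p))

-- Enumerating S_n

splits : ℕ → List ℕ → List (List ℕ)
splits N []      = []
splits N (a ∷ q) = (N ∷ q ∷ʳ a) ∷ map (a ∷_) (splits N q)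

-- The permutations of [N] from which deleting N out of its cycle leaves w ∈ S_{N-1}, in one-line
-- notation: w ∷ʳ N fixes N, and for w = p ++ a ∷ q the split p ++ N ∷ q ∷ʳ a sends |p| + 1 to N
-- and N to a.
children : ℕ → List ℕ → List (List ℕ)
children N w = (w ∷ʳ N) ∷ splits N w

permutations : ℕ → List (List ℕ)
permutations zero    = [] ∷ []
permutations (suc m) = concatMap (children (suc m)) (permutations m)

∈-splits⁻ : ∀ {z} N w → z ∈ splits N w →
  ∃[ p ] ∃[ a ] ∃[ q ] (w ≡ p ++ a ∷ q × z ≡ p ++ N ∷ q ∷ʳ a)
∈-splits⁻ N (a ∷ q) (here refl) = [] , a , q , refl , refl
∈-splits⁻ N (a ∷ q) (there z∈) with ∈-map⁻ (a ∷_) z∈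
... | z′ , z′∈ , refl with ∈-splits⁻ N q z′∈
...   | p , b , q′ , refl , refl = a ∷ p , b , q′ , refl , refl

∈-splits⁺ : ∀ N p a q → p ++ N ∷ q ∷ʳ a ∈ splits N (p ++ a ∷ q)
∈-splits⁺ N []      a q = here refl
∈-splits⁺ N (b ∷ p) a q = there (∈-map⁺ (b ∷_) (∈-splits⁺ N p a q))

length-splits : ∀ N w → length (splits N w) ≡ length w
length-splits N []      = refl
length-splits N (a ∷ q) = cong suc (trans (length-map (a ∷_) (splits N q)) (length-splits N q))

split-↭ : ∀ p (a N : ℕ) q → p ++ N ∷ q ∷ʳ a ↭ (p ++ a ∷ q) ∷ʳ N
split-↭ p a N q = ↭-trans (shift N p (q ∷ʳ a))
  (↭-trans (↭-prep N (++⁺ˡ p (↭-sym (∷↭∷ʳ a q)))) (∷↭∷ʳ N (p ++ a ∷ q)))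

∷ʳ-cancel-↭ : ∀ {xs ys : List ℕ} {x} → xs ∷ʳ x ↭ ys ∷ʳ x → xs ↭ ys
∷ʳ-cancel-↭ {xs} {ys} p =
  subst₂ _↭_ (++-identityʳ xs) (++-identityʳ ys) (drop-mid xs ys p)

∈-permutations⁻ : ∀ m {w} → w ∈ permutations m → w ↭ range1 m
∈-permutations⁻ zero    (here refl) = ↭-refl
∈-permutations⁻ (suc m) w∈ with find (∈-concatMap⁻ (children (suc m)) w∈)
... | w′ , w′∈ , here refl rewrite range1-suc m = ++⁺ʳ (suc m ∷ []) (∈-permutations⁻ m w′∈)
... | w′ , w′∈ , there z∈ with ∈-splits⁻ (suc m) w′ z∈
...   | p , a , q , refl , refl rewrite range1-suc m =
  ↭-trans (split-↭ p a (suc m) q) (++⁺ʳ (suc m ∷ []) (∈-permutations⁻ m w′∈))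

∈-permutations⁺ : ∀ m {w} → w ↭ range1 m → w ∈ permutations m
∈-permutations⁺ zero    w↭ with refl ← ↭-empty-inv w↭ = here refl
∈-permutations⁺ (suc m) {w} w↭ with ∈-∃++ (∈-resp-↭ (↭-sym w↭) (range1-⁺ (s≤s z≤n) ≤-refl))
... | p , s , refl = fromParent s (initLast s) (subst (p ++ suc m ∷ s ↭_) (range1-suc m) w↭)
  where
  N = suc m
  fromParent : ∀ s → InitLast s → p ++ N ∷ s ↭ range1 m ∷ʳ N → p ++ N ∷ s ∈ permutations N
  fromParent .[] [] ↭N =
    ∈-concatMap⁺ (children N) (lose (∈-permutations⁺ m (∷ʳ-cancel-↭ ↭N)) (here refl))
  fromParent .(q ∷ʳ a) (q ∷ʳ′ a) ↭N =
    ∈-concatMap⁺ (children N) (lose (∈-permutations⁺ m parent↭) (there (∈-splits⁺ N p a q)))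
    where
    parent↭ : p ++ a ∷ q ↭ range1 m
    parent↭ = ∷ʳ-cancel-↭ (↭-trans (↭-sym (split-↭ p a N q)) ↭N)

length-permutation : ∀ m {w} → w ∈ permutations m → length w ≡ m
length-permutation m w∈ = trans (↭-length (∈-permutations⁻ m w∈)) (length-range1 m)

replace : ℕ → ℕ → List ℕ → List ℕ
replace N x = map (λ y → if y ≡ᵇ N then x else y)

replace-∉ : ∀ {N} x v → N ∉ v → replace N x v ≡ v
replace-∉     x []      _  = refl
replace-∉ {N} x (y ∷ v) N∉ rewrite ≢⇒≡ᵇ-false {y} {N} (λ y≡N → N∉ (here (sym y≡N))) =
  cong (y ∷_) (replace-∉ x v (N∉ ∘ there))

-- A child remembers its parent: drop its last entry x and write x in place of N.
∈-children⁻ : ∀ {N w z} → N ∉ w → z ∈ children N w → ∃[ v ] ∃[ x ] (z ≡ v ∷ʳ x × w ≡ replace N x v)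
∈-children⁻ {N} {w} N∉ (here refl) = w , N , refl , sym (replace-∉ N w N∉)
∈-children⁻ {N} {w} N∉ (there z∈) with ∈-splits⁻ N w z∈
... | p , a , q , refl , refl = p ++ N ∷ q , a , sym (++-assoc p (N ∷ q) (a ∷ [])) , sym restored
  where
  restored : replace N a (p ++ N ∷ q) ≡ p ++ a ∷ q
  restored rewrite map-++ (λ y → if y ≡ᵇ N then a else y) p (N ∷ q) | ≡ᵇ-refl N
                 | replace-∉ a p (N∉ ∘ ∈-++⁺ˡ) | replace-∉ a q (N∉ ∘ ∈-++⁺ʳ p ∘ there) = refl

children-disjoint : ∀ {N w₁ w₂ z} → N ∉ w₁ → N ∉ w₂ → z ∈ children N w₁ → z ∈ children N w₂ → w₁ ≡ w₂
children-disjoint N∉w₁ N∉w₂ z∈₁ z∈₂ with ∈-children⁻ N∉w₁ z∈₁ | ∈-children⁻ N∉w₂ z∈₂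
... | v₁ , x₁ , refl , refl | v₂ , x₂ , z≡ , refl with ∷ʳ-injective v₁ v₂ z≡
...   | refl , refl = refl

splits-unique : ∀ {N} w → N ∉ w → Unique (splits N w)
splits-unique         []      _  = []
splits-unique {N} (a ∷ q) N∉ =
  Allₚ.map⁺ (All.universal (λ z N∷≡a∷ → N∉ (here (∷-injectiveˡ N∷≡a∷))) (splits N q)) ∷
  Unique-map⁺ ∷-injectiveʳ (splits-unique q (N∉ ∘ there))

∷ʳ-∉-splits : ∀ {N} w → N ∉ w → w ∷ʳ N ∉ splits N w
∷ʳ-∉-splits (a ∷ q) N∉ (here a∷≡N∷) = N∉ (here (sym (∷-injectiveˡ a∷≡N∷)))
∷ʳ-∉-splits (a ∷ q) N∉ (there z∈) with ∈-map⁻ (a ∷_) z∈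
... | z , z∈′ , a∷≡a∷ = ∷ʳ-∉-splits q (N∉ ∘ there)
                          (subst (_∈ _) (sym (∷-injectiveʳ a∷≡a∷)) z∈′)

children-unique : ∀ {N} w → N ∉ w → Unique (children N w)
children-unique w N∉ =
  All.tabulate (λ z∈ w∷≡z → ∷ʳ-∉-splits w N∉ (subst (_∈ _) (sym w∷≡z) z∈)) ∷ splits-unique w N∉

concatMap-unique : ∀ {A B : Set} {f : A → List B} xs → Unique xs → (∀ {x} → x ∈ xs → Unique (f x)) →
  (∀ {x y z} → x ∈ xs → y ∈ xs → z ∈ f x → z ∈ f y → x ≡ y) → Unique (concatMap f xs)
concatMap-unique         []       _             _  _     = []
concatMap-unique {f = f} (x ∷ xs) x∷xs!@(_ ∷ xs!) f! fibre =
  Unique-++⁺ (f! (here refl)) (concatMap-unique xs xs! (f! ∘ there) (λ x∈ y∈ → fibre (there x∈) (there y∈)))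
    disjoint
  where
  disjoint : Disjoint (f x) (concatMap f xs)
  disjoint (z∈fx , z∈rest) with find (∈-concatMap⁻ f z∈rest)
  ... | y , y∈xs , z∈fy with fibre (here refl) (there y∈xs) z∈fx z∈fy
  ...   | refl = Unique[x∷xs]⇒x∉xs x∷xs! y∈xs

max∉permutations : ∀ m {w} → w ∈ permutations m → suc m ∉ w
max∉permutations m w∈ N∈w = 1+n≰n (proj₂ (range1-⁻ (∈-resp-↭ (∈-permutations⁻ m w∈) N∈w)))

permutations-unique : ∀ m → Unique (permutations m)
permutations-unique zero    = [] ∷ []
permutations-unique (suc m) =
  concatMap-unique (permutations m) (permutations-unique m)
    (λ w∈ → children-unique _ (max∉permutations m w∈))
    (λ w₁∈ w₂∈ → children-disjoint (max∉permutations m w₁∈) (max∉permutations m w₂∈))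

standardDecomposition : ∀ m {w} → w ∈ permutations m → ∃[ C ] StandardDecomposition m (app w) C
standardDecomposition zero    (here refl) = [] , ↭-refl , tt , tt
standardDecomposition (suc m) w∈ with find (∈-concatMap⁻ (children (suc m)) w∈)
... | w′ , w′∈ , z∈ with standardDecomposition m w′∈ | length-permutation m w′∈
... | C , d | len with z∈
...   | here refl = _ , appendMax-decomposition w′ len d
...   | there z∈′ with ∈-splits⁻ (suc m) w′ z∈′
...     | p , a , q , refl , refl = _ , splitMax-decomposition p a q len d

-- Peaks after inserting a maximal letter

insertions : ℕ → List ℕ → List (List ℕ)
insertions N []       = []
insertions N (x ∷ xs) = (x ∷ N ∷ xs) ∷ map (x ∷_) (insertions N xs)

length-insertions : ∀ N xs → length (insertions N xs) ≡ length xs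
length-insertions N []       = refl
length-insertions N (x ∷ xs) = cong suc (trans (length-map (x ∷_) (insertions N xs)) (length-insertions N xs))

insertions-insertAfter : ∀ N u → Unique u → insertions N u ≡ map (λ j → insertAfter j N u) u
insertions-insertAfter N []       _             = refl
insertions-insertAfter N (x ∷ xs) x∷xs!@(_ ∷ xs!) = cong₂ _∷_ first rest
  where
  x∉xs = Unique[x∷xs]⇒x∉xs x∷xs!
  first : x ∷ N ∷ xs ≡ insertAfter x N (x ∷ xs)
  first rewrite ≡ᵇ-refl x | insertAfter-∉ N xs x∉xs = refl
  skip-x : ∀ {j} → j ∈ xs → x ∷ insertAfter j N xs ≡ insertAfter j N (x ∷ xs)
  skip-x {j} j∈xs rewrite ≢⇒≡ᵇ-false {x} {j} (λ x≡j → x∉xs (subst (_∈ xs) (sym x≡j) j∈xs)) = refl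
  rest : map (x ∷_) (insertions N xs) ≡ map (λ j → insertAfter j N (x ∷ xs)) xs
  rest = begin
    map (x ∷_) (insertions N xs)                      ≡⟨ cong (map (x ∷_)) (insertions-insertAfter N xs xs!) ⟩
    map (x ∷_) (map (λ j → insertAfter j N xs) xs)    ≡⟨ map-∘ xs ⟨
    map (λ j → x ∷ insertAfter j N xs) xs             ≡⟨ map-cong-local (All.tabulate skip-x) ⟩
    map (λ j → insertAfter j N (x ∷ xs)) xs           ∎

peak : ℕ → ℕ → ℕ → ℕ
peak a b c = if (a ≤ᵇ b) ∧ (c ≤ᵇ b) then 1 else 0

peak-top : ∀ {a b c} → a ≤ b → c ≤ b → peak a b c ≡ 1
peak-top a≤b c≤b rewrite ≤⇒≤ᵇ≡true a≤b | ≤⇒≤ᵇ≡true c≤b = refl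

peak-descent : ∀ {a b} c → b < a → peak a b c ≡ 0
peak-descent c b<a rewrite >⇒≤ᵇ≡false b<a = refl

peak-ascent : ∀ a {b c} → b < c → peak a b c ≡ 0
peak-ascent a {b} b<c rewrite >⇒≤ᵇ≡false b<c | ∧-zeroʳ (a ≤ᵇ b) = refl

peaks-∷ʳ-max : ∀ {N} u → All (_< N) u → peaks (u ∷ʳ N) ≡ peaks u
peaks-∷ʳ-max []                _                      = refl
peaks-∷ʳ-max (a ∷ [])          _                      = refl
peaks-∷ʳ-max (a ∷ b ∷ [])      (_ ∷ b<N ∷ [])         = cong (_+ 0) (peak-ascent a b<N)
peaks-∷ʳ-max (a ∷ b ∷ c ∷ r)   (_ ∷ b<N ∷ c<N ∷ r<N) = cong (peak a b c +_) (peaks-∷ʳ-max (b ∷ c ∷ r) (b<N ∷ c<N ∷ r<N))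

sum-peaks-∷ : ∀ x y z V → sum (map peaks (map (x ∷_) (map (y ∷_) (map (z ∷_) V)))) ≡
  length V * peak x y z + sum (map peaks (map (y ∷_) (map (z ∷_) V)))
sum-peaks-∷ x y z []      = refl
sum-peaks-∷ x y z (v ∷ V) rewrite sum-peaks-∷ x y z V =
  rearrange (peak x y z) (peaks (y ∷ z ∷ v)) (length V) (sum (map peaks (map (y ∷_) (map (z ∷_) V))))
  where
  rearrange : ∀ p a l s → p + a + (l * p + s) ≡ p + l * p + (a + s)
  rearrange = solve-∀

InsertionsPeaks : ℕ → ℕ → List ℕ → Set
InsertionsPeaks N x xs = peaks (x ∷ xs) + sum (map peaks (insertions N (x ∷ xs))) ≡ length xs * (peaks (x ∷ xs) + 1)

-- With P = peaks (y ∷ z ∷ r) and p = peak x y z: inserting N after x gives 1 + P peaks, after y it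
-- gives peaks (y ∷ N ∷ z ∷ r), and after a later letter it gives p plus the peaks of the same
-- insertion into y ∷ z ∷ r.
peaks-insertions-∷ : ∀ N x y z r → x < N → y < N → InsertionsPeaks N y (z ∷ r) → InsertionsPeaks N x (y ∷ z ∷ r)
peaks-insertions-∷ N x y z r x<N y<N IH
  rewrite peak-top (<⇒≤ x<N) (<⇒≤ y<N) | peak-descent z y<N | peak-ascent x y<N
        | sum-peaks-∷ x y z ((N ∷ r) ∷ insertions N r) | length-insertions N r
  = step (peaks (y ∷ z ∷ r)) (peaks (y ∷ N ∷ z ∷ r))
         (sum (map peaks (map (y ∷_) (map (z ∷_) ((N ∷ r) ∷ insertions N r))))) (length r) (peak x y z) IH
  where
  step : ∀ P A B l p → P + (A + B) ≡ suc l * (P + 1) →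
    p + P + (suc P + (A + (suc l * p + B))) ≡ suc (suc l) * (p + P + 1)
  step P A B l p IH = begin
    p + P + (suc P + (A + (suc l * p + B)))    ≡⟨ regroup P A B l p ⟩
    P + (A + B) + (suc P + suc l * p + p)      ≡⟨ cong (_+ (suc P + suc l * p + p)) IH ⟩
    suc l * (P + 1) + (suc P + suc l * p + p)  ≡⟨ collect P l p ⟩
    suc (suc l) * (p + P + 1)                  ∎
    where
    regroup : ∀ P A B l p → p + P + (suc P + (A + (suc l * p + B))) ≡ P + (A + B) + (suc P + suc l * p + p)
    regroup = solve-∀
    collect : ∀ P l p → suc l * (P + 1) + (suc P + suc l * p + p) ≡ suc (suc l) * (p + P + 1)
    collect = solve-∀

peaks-insertions : ∀ N x xs → All (_< N) (x ∷ xs) → InsertionsPeaks N x xs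
peaks-insertions N x []          _                 = refl
peaks-insertions N x (y ∷ [])    (x<N ∷ y<N ∷ [])
  rewrite peak-top (<⇒≤ x<N) (<⇒≤ y<N) | peak-ascent x y<N = refl
peaks-insertions N x (y ∷ z ∷ r) (x<N ∷ y<N ∷ z∷r<N) =
  peaks-insertions-∷ N x y z r x<N y<N (peaks-insertions N y (z ∷ r) (y<N ∷ z∷r<N))

sum-concatMap : ∀ {A B : Set} (g : B → ℕ) (f : A → List B) xs →
  sum (map g (concatMap f xs)) ≡ sum (map (λ x → sum (map g (f x))) xs)
sum-concatMap g f []       = refl
sum-concatMap g f (x ∷ xs) = begin
  sum (map g (f x ++ concatMap f xs))                   ≡⟨ cong sum (map-++ g (f x) _) ⟩
  sum (map g (f x) ++ map g (concatMap f xs))           ≡⟨ sum-++ (map g (f x)) _ ⟩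
  sum (map g (f x)) + sum (map g (concatMap f xs))      ≡⟨ cong (sum (map g (f x)) +_) (sum-concatMap g f xs) ⟩
  sum (map g (f x)) + sum (map (λ x → sum (map g (f x))) xs) ∎

length-concatMap : ∀ {A B : Set} (f : A → List B) xs → length (concatMap f xs) ≡ sum (map (length ∘ f) xs)
length-concatMap f []       = refl
length-concatMap f (x ∷ xs) = trans (length-++ (f x)) (cong (length (f x) +_) (length-concatMap f xs))

sum-map-const : ∀ {A : Set} (c : ℕ) (xs : List A) → sum (map (λ _ → c) xs) ≡ length xs * c
sum-map-const c []       = refl
sum-map-const c (x ∷ xs) = cong (c +_) (sum-map-const c xs)

sum-map-*-suc : ∀ {A : Set} k (g : A → ℕ) xs → sum (map (λ x → k * (g x + 1)) xs) ≡ k * (sum (map g xs) + length xs)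
sum-map-*-suc k g []       = sym (*-zeroʳ k)
sum-map-*-suc k g (x ∷ xs) rewrite sum-map-*-suc k g xs = distrib k (g x) (sum (map g xs)) (length xs)
  where
  distrib : ∀ k a s l → k * (a + 1) + k * (s + l) ≡ k * (a + s + suc l)
  distrib = solve-∀

sum-splits : ∀ N (F : List ℕ → ℕ) (G : ℕ → ℕ) w → (∀ p a q → w ≡ p ++ a ∷ q → F (p ++ N ∷ q ∷ʳ a) ≡ G (length p)) →
  sum (map F (splits N w)) ≡ sum (applyUpTo G (length w))
sum-splits N F G []      _     = refl
sum-splits N F G (a ∷ q) F≗G = cong₂ _+_ (F≗G [] a q refl) (begin
  sum (map F (map (a ∷_) (splits N q)))  ≡⟨ cong sum (map-∘ (splits N q)) ⟨
  sum (map (F ∘ (a ∷_)) (splits N q))    ≡⟨ sum-splits N (F ∘ (a ∷_)) (G ∘ suc) q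
                                              (λ p b q′ q≡ → F≗G (a ∷ p) b q′ (cong (a ∷_) q≡)) ⟩
  sum (applyUpTo (G ∘ suc) (length q))   ∎)

map-range1 : ∀ {A : Set} (G : ℕ → A) m → map G (range1 m) ≡ applyUpTo (G ∘ suc) m
map-range1 G m = trans (sym (map-∘ (upTo m))) (map-applyUpTo id (G ∘ suc) m)

flattenPeaks : ℕ → List ℕ → ℕ
flattenPeaks n w = peaks (Flatten n w)

-- The fixed-point child keeps the peaks of Flatten w; the other children insert N after each letter.
sum-children-peaks : ∀ m {w} → w ∈ permutations (suc m) →
  sum (map (flattenPeaks (suc (suc m))) (children (suc (suc m)) w)) ≡ m * (flattenPeaks (suc m) w + 1)
sum-children-peaks m {w} w∈ with standardDecomposition (suc m) w∈
... | C , d@(C↭ , _) = begin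
  flattenPeaks N (w ∷ʳ N) + sum (map (flattenPeaks N) (splits N w))  ≡⟨ cong₂ _+_ fixed-child split-children ⟩
  peaks u + sum (map peaks (insertions N u))                          ≡⟨ all-insertions u (trans (↭-length C↭) (length-range1 M)) u<N ⟩
  m * (peaks u + 1)                                                   ≡⟨ cong (λ v → m * (peaks v + 1)) (Flatten-standard w d) ⟨
  m * (flattenPeaks M w + 1)                                          ∎
  where
  M = suc m
  N = suc M
  u = concatCycles C
  len : length w ≡ M
  len = length-permutation M w∈
  u<N : All (_< N) u
  u<N = All.tabulate (s≤s ∘ proj₂ ∘ entries-range d)
  fixed-child : flattenPeaks N (w ∷ʳ N) ≡ peaks u
  fixed-child = begin
    peaks (Flatten N (w ∷ʳ N))        ≡⟨ cong peaks (Flatten-standard (w ∷ʳ N) (appendMax-decomposition w len d)) ⟩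
    peaks (concatCycles (C ∷ʳ (N , []))) ≡⟨ cong peaks (concatCycles-++ C _) ⟩
    peaks (u ∷ʳ N)                    ≡⟨ peaks-∷ʳ-max u u<N ⟩
    peaks u                           ∎
  G : ℕ → ℕ
  G j = peaks (insertAfter j N u)
  split-child : ∀ p a q → w ≡ p ++ a ∷ q → flattenPeaks N (p ++ N ∷ q ∷ʳ a) ≡ G (suc (length p))
  split-child p a q refl =
    cong peaks (trans (Flatten-standard (p ++ N ∷ q ∷ʳ a) (splitMax-decomposition p a q len d)) (concatCycles-insert _ N C))
  split-children : sum (map (flattenPeaks N) (splits N w)) ≡ sum (map peaks (insertions N u))
  split-children = begin
    sum (map (flattenPeaks N) (splits N w))   ≡⟨ sum-splits N _ (G ∘ suc) w split-child ⟩
    sum (applyUpTo (G ∘ suc) (length w))      ≡⟨ cong (sum ∘ applyUpTo (G ∘ suc)) len ⟩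
    sum (applyUpTo (G ∘ suc) M)               ≡⟨ cong sum (map-range1 G M) ⟨
    sum (map G (range1 M))                    ≡⟨ sum-↭ (map⁺ G C↭) ⟨
    sum (map G u)                             ≡⟨ cong sum (map-∘ u) ⟩
    sum (map peaks (map (λ j → insertAfter j N u) u))
      ≡⟨ cong (sum ∘ map peaks) (insertions-insertAfter N u (Unique-resp-↭ (↭-sym C↭) (range1-unique M))) ⟨
    sum (map peaks (insertions N u))          ∎
  all-insertions : ∀ v → length v ≡ M → All (_< N) v → peaks v + sum (map peaks (insertions N v)) ≡ m * (peaks v + 1)
  all-insertions (x ∷ xs) |v|≡M v<N =
    subst (λ l → peaks (x ∷ xs) + sum (map peaks (insertions N (x ∷ xs))) ≡ l * (peaks (x ∷ xs) + 1))
      (suc-injective |v|≡M) (peaks-insertions N x xs v<N)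

peakTotal : ℕ → ℕ
peakTotal n = sum (map (flattenPeaks n) (permutations n))

peakTotal-suc-suc : ∀ m → peakTotal (suc (suc m)) ≡ m * (peakTotal (suc m) + length (permutations (suc m)))
peakTotal-suc-suc m = begin
  sum (map F (concatMap (children N) Ps))                ≡⟨ sum-concatMap F (children N) Ps ⟩
  sum (map (λ w → sum (map F (children N w))) Ps)        ≡⟨ cong sum (map-cong-local (All.tabulate (sum-children-peaks m))) ⟩
  sum (map (λ w → m * (flattenPeaks (suc m) w + 1)) Ps)  ≡⟨ sum-map-*-suc m (flattenPeaks (suc m)) Ps ⟩
  m * (peakTotal (suc m) + length Ps)                    ∎
  where
  N = suc (suc m)
  F = flattenPeaks N
  Ps = permutations (suc m)

length-permutations-suc : ∀ m → length (permutations (suc m)) ≡ length (permutations m) * suc m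
length-permutations-suc m = begin
  length (concatMap (children (suc m)) Ps)            ≡⟨ length-concatMap (children (suc m)) Ps ⟩
  sum (map (length ∘ children (suc m)) Ps)            ≡⟨ cong sum (map-cong-local (All.tabulate length-children)) ⟩
  sum (map (λ _ → suc m) Ps)                          ≡⟨ sum-map-const (suc m) Ps ⟩
  length Ps * suc m                                   ∎
  where
  Ps = permutations m
  length-children : ∀ {w} → w ∈ Ps → length (children (suc m) w) ≡ suc m
  length-children {w} w∈ = cong suc (trans (length-splits (suc m) w) (length-permutation m w∈))

peakTotal-closed : ∀ m → 3 * peakTotal (suc (suc m)) ≡ m * length (permutations (suc (suc m)))
peakTotal-closed zero    rewrite peakTotal-suc-suc 0 = refl
peakTotal-closed (suc k) = begin
  3 * peakTotal (3 + k)                   ≡⟨ cong (3 *_) (peakTotal-suc-suc (suc k)) ⟩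
  3 * (suc k * (S + L))                   ≡⟨ distribute (suc k) S L ⟩
  suc k * (3 * S + 3 * L)                 ≡⟨ cong (λ t → suc k * (t + 3 * L)) (peakTotal-closed k) ⟩
  suc k * (k * L + 3 * L)                 ≡⟨ collect k L ⟩
  suc k * (L * (3 + k))                   ≡⟨ cong (suc k *_) (length-permutations-suc (2 + k)) ⟨
  suc k * length (permutations (3 + k))   ∎
  where
  S = peakTotal (2 + k)
  L = length (permutations (2 + k))
  distribute : ∀ a s l → 3 * (a * (s + l)) ≡ a * (3 * s + 3 * l)
  distribute = solve-∀
  collect : ∀ k l → suc k * (k * l + 3 * l) ≡ suc k * (l * (3 + k))
  collect = solve-∀

corollary3p12 : (n : ℕ) → 2 ≤ n → (Ls : List (List ℕ)) → Unique Ls →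
    ((w : List ℕ) → (w ∈ Ls) ⇔ (w ↭ range1 n)) →
    3 * sum (map (λ w → peaks (Flatten n w)) Ls) ≡ (n ∸ 2) * length Ls
corollary3p12 (suc (suc m)) (s≤s (s≤s z≤n)) Ls Ls! Ls⇔S = begin
  3 * sum (map (flattenPeaks n) Ls)  ≡⟨ cong (3 *_) (sum-↭ (map⁺ (flattenPeaks n) Ls↭)) ⟩
  3 * peakTotal n                    ≡⟨ peakTotal-closed m ⟩
  m * length (permutations n)        ≡⟨ cong (m *_) (↭-length Ls↭) ⟨
  m * length Ls                      ∎
  where
  n = suc (suc m)
  Ls↭ : Ls ↭ permutations n
  Ls↭ = ∼bag⇒↭ (unique∧set⇒bag Ls! (permutations-unique n) λ {w} →
    mk⇔ (∈-permutations⁺ n ∘ Equivalence.to (Ls⇔S w)) (Equivalence.from (Ls⇔S w) ∘ ∈-permutations⁻ n))
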